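{- Assume that the proof system for ordinary Hoare triples (deriving judgments $\vdash \{\Phi\}\,\mathbb{P}\,\{\Phi'\}$) is sound and that the proof system for under-approximate Hoare triples (deriving judgments $\vdash [\Phi]\,\mathbb{P}\,[\Phi']$) is sound. If the Forall-Exist Hoare Tuple with precondition $\Phi$, universally quantified program list $\overline{\chi_\forall}$, existentially quantified program list $\overline{\chi_\exists}$ and postcondition $\Psi$ is derivable in Forall-Exist Hoare Logic, then this Forall-Exist Hoare Tuple is valid.
   Context: Programs are built from: skip; deterministic assignment $x := e$; $\mathtt{assume}(b)$; $\mathtt{if}(b,\mathbb{P},\mathbb{Q})$; $\mathtt{while}(b,\mathbb{P})$; sequential composition $\mathbb{P};\mathbb{Q}$; and nondeterministic assignment $x := \star$ (assigning an arbitrary integer). States are maps $\sigma:\mathcal{V}\to\mathbb{Z}$, and $[\![\mathbb{P}]\!](\sigma,\sigma')$ means $\mathbb{P}$ executed from $\sigma$ can terminate in $\sigma'$ (standard big-step semantics; $\mathtt{assume}(b)$ blocks on states violating $b$). For states over disjoint variable sets, $\sigma_1\oplus\sigma_2$ is the combined state; $\mathcal{V}_i=\{x_i\mid x\in\mathcal{V}\}$ are indexed variable copies. Assertions are first-order formulas over these variables. A Forall-Exist Hoare Tuple (FEHT) consists of a precondition $\Phi$ and postcondition $\Psi$ (assertions over $\bigcup_{i=1}^{k+l}\mathcal{V}_i$), a list $\overline{\chi_\forall}=\mathbb{P}_1,\ldots,\mathbb{P}_k$ of universally quantified programs and a list $\overline{\chi_\exists}=\mathbb{P}_{k+1},\ldots,\mathbb{P}_{k+l}$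 of existentially quantified programs, where $\mathbb{P}_i$ operates on $\mathcal{V}_i$. It is valid if for all states $\sigma_1,\ldots,\sigma_{k+l}$ and $\sigma'_1,\ldots,\sigma'_k$ with $\bigoplus_{i=1}^{k+l}\sigma_i\models\Phi$ and $[\![\mathbb{P}_i]\!](\sigma_i,\sigma'_i)$ for all $i\in[1,k]$, there exist $\sigma'_{k+1},\ldots,\sigma'_{k+l}$ with $[\![\mathbb{P}_i]\!](\sigma_i,\sigma'_i)$ for all $i\in[k+1,k+l]$ and $\bigoplus_{i=1}^{k+l}\sigma'_i\models\Psi$. A Hoare triple $\{\Phi\}\,\mathbb{P}\,\{\Phi'\}$ is valid if every terminating execution of $\mathbb{P}$ from a state satisfying $\Phi$ ends in a state satisfying $\Phi'$. An under-approximate Hoare triple $[\Phi]\,\mathbb{P}\,[\Phi']$ is valid if for every state $\sigma\models\Phi$ there exists $\sigma'$ with $[\![\mathbb{P}]\!](\sigma,\sigma')$ and $\sigma'\models\Phi'$. Forall-Exist Hoare Logic (FEHL) derives FEHTs with the following rules (each universal rule has an analogous existential counterpart where marked): reordering of the universal (resp. existential) program list; rewriting $\mathbb{P}$ to $\mathbb{P};\mathtt{skip}$ and eliminating a lone $\mathtt{skip}$ program (both sides); reassociating $(\mathbb{P}_1;\mathbb{P}_2);\mathbb{P}_3$ to $\mathbb{P}_1;(\mathbb{P}_2;\mathbb{P}_3)$ (both sides); (Done) deriving the tuple with both lists empty and pre- equal to postcondition; (Cons) strengthening the precondition and weakening the postcondition; (If) for $\mathtt{if}(b,\mathbb{P}_1,\mathbb{P}_2);\mathbb{P}_3$,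 splitting into premises with preconditions $\Phi\wedge b$ (program $\mathbb{P}_1;\mathbb{P}_3$) and $\Phi\wedge\neg b$ (program $\mathbb{P}_2;\mathbb{P}_3$) (both sides); ($\forall$-Step) for a universal program $\mathbb{P}_1;\mathbb{P}_2$, from $\vdash\{\Phi\}\,\mathbb{P}_1\,\{\Phi'\}$ and a derivation with precondition $\Phi'$ and $\mathbb{P}_2$ in its place; ($\exists$-Step) the same for an existential program using $\vdash[\Phi]\,\mathbb{P}_1\,[\Phi']$; ($\forall$-Assume) for universal $\mathtt{assume}(b);\mathbb{P}$, continue with precondition $\Phi\wedge b$; ($\exists$-Assume) for existential $\mathtt{assume}(b);\mathbb{P}$, require $\Phi\Rightarrow b$ and continue with $\mathbb{P}$; ($\forall$-Choice) for universal $x:=\star;\mathbb{P}$, continue with precondition $\exists x.\Phi$; ($\exists$-Choice) for existential $x:=\star;\mathbb{P}$, for any expression $e$ with $x\notin\mathit{Vars}(e)$, continue with precondition $(\exists x.\Phi)\wedge x=e$; havoc rules that drop a program $\mathbb{P}$ and existentially quantify its modified variables in the precondition (for existential programs additionally requiring $\vdash[\Phi]\,\mathbb{P}\,[\top]$); and a counting-based loop rule aligning the loops $\mathtt{while}(b_i,\mathbb{P}_i);\mathbb{Q}_i$ of all $k\ge1$ universal and $l$ existential programs via an invariant $\mathbb{I}$ (implied by $\Phi$, implying that all guards $b_i$ agree, with intermediate assertions $\mathbb{I}=\mathbb{I}_1,\ldots,\mathbb{I}_{B+1}=\mathbb{I}$ and counts $c_i\in[1,B]$ such that in round $j$ the bodies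 with $c_i\ge j$ are executed from $\mathbb{I}_j\wedge$ their guards to reach $\mathbb{I}_{j+1}\wedge$ the guards of loops with $c_i>j$), and continuing with the suffixes $\mathbb{Q}_i$ from $\mathbb{I}\wedge\bigwedge_i\neg b_i$. -}

module Defs where

open import Level using (0ℓ)
open import Data.Bool using (Bool; true; false; if_then_else_; not; _∧_; _∨_)
open import Data.Nat as ℕ using (ℕ; zero; suc; _≡ᵇ_)
open import Data.Integer as ℤ using (ℤ)
open import Data.Product using (Σ; Σ-syntax; _×_; _,_; proj₁)
open import Data.Sum using (_⊎_)
open import Data.List using (List; []; _∷_; _++_; map; filterᵇ)
open import Data.List.Relation.Unary.All using (All)
open import Data.List.Membership.Propositional using (_∈_; _∉_)
open import Data.List.Relation.Binary.Permutation.Propositional using (_↭_)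
open import Relation.Binary.PropositionalEquality using (_≡_; _≢_)
open import Relation.Nullary using (¬_)
open import Relation.Nullary.Decidable using (⌊_⌋)

-- Arithmetic expressions are
-- parametric in the type of variables: programs use  Exp ℕ, assertions
-- use  Exp (ℕ × ℕ)  where (i , x) stands for the indexed variable x_i.
data Exp (V : Set) : Set where
  const : ℤ → Exp V
  var   : V → Exp V
  _⊕_   : Exp V → Exp V → Exp V
  _⊖_   : Exp V → Exp V → Exp V
  _⊛_   : Exp V → Exp V → Exp V

vars : {V : Set} → Exp V → List V
vars (const _) = []
vars (var x)   = x ∷ []
vars (a ⊕ b)   = vars a ++ vars b
vars (a ⊖ b)   = vars a ++ vars b
vars (a ⊛ b)   = vars a ++ vars b

data BExp : Set where
  tt ff : BExp
  bnot  : BExp → BExp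
  band bor : BExp → BExp → BExp
  beq ble blt : Exp ℕ → Exp ℕ → BExp

data Prog : Set where
  skip   : Prog
  _≔_    : ℕ → Exp ℕ → Prog
  assume : BExp → Prog
  if′    : BExp → Prog → Prog → Prog
  while  : BExp → Prog → Prog
  _⨾_    : Prog → Prog → Prog
  _≔⋆    : ℕ → Prog

mod : Prog → List ℕ
mod skip          = []
mod (x ≔ _)       = x ∷ []
mod (assume _)    = []
mod (if′ _ P Q)   = mod P ++ mod Q
mod (while _ P)   = mod P
mod (P ⨾ Q)       = mod P ++ mod Q
mod (x ≔⋆)        = x ∷ []

Store : Set
Store = ℕ → ℤ

evalE : {V : Set} → Exp V → (V → ℤ) → ℤ
evalE (const n) s = n
evalE (var x)   s = s x
evalE (a ⊕ b)   s = evalE a s ℤ.+ evalE b s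
evalE (a ⊖ b)   s = evalE a s ℤ.- evalE b s
evalE (a ⊛ b)   s = evalE a s ℤ.* evalE b s

evalB : BExp → Store → Bool
evalB tt         s = true
evalB ff         s = false
evalB (bnot b)   s = not (evalB b s)
evalB (band a b) s = evalB a s ∧ evalB b s
evalB (bor a b)  s = evalB a s ∨ evalB b s
evalB (beq a b)  s = ⌊ evalE a s ℤ.≟ evalE b s ⌋
evalB (ble a b)  s = evalE a s ℤ.≤ᵇ evalE b s
evalB (blt a b)  s = ⌊ evalE a s ℤ.<? evalE b s ⌋

set : Store → ℕ → ℤ → Store
set s x v y = if y ≡ᵇ x then v else s y

data Exec : Prog → Store → Store → Set where
  ex-skip   : ∀ {s} → Exec skip s s
  ex-assign : ∀ {s x e} → Exec (x ≔ e) s (set s x (evalE e s))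
  ex-assume : ∀ {s b} → evalB b s ≡ true → Exec (assume b) s s
  ex-ifT    : ∀ {s t b P Q} → evalB b s ≡ true → Exec P s t → Exec (if′ b P Q) s t
  ex-ifF    : ∀ {s t b P Q} → evalB b s ≡ false → Exec Q s t → Exec (if′ b P Q) s t
  ex-whileT : ∀ {s t u b P} → evalB b s ≡ true → Exec P s t →
              Exec (while b P) t u → Exec (while b P) s u
  ex-whileF : ∀ {s b P} → evalB b s ≡ false → Exec (while b P) s s
  ex-seq    : ∀ {s t u P Q} → Exec P s t → Exec Q t u → Exec (P ⨾ Q) s u
  ex-havoc  : ∀ {s x} (v : ℤ) → Exec (x ≔⋆) s (set s x v)

-- A combined state: component i is the state σ_i over the copy 𝒱_i.
GState : Set
GState = ℕ → Store

upd : GState → ℕ → Store → GState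
upd Σ' i s j = if j ≡ᵇ i then s else Σ' j

Assertion : Set₁
Assertion = GState → Set

evalA : Exp (ℕ × ℕ) → GState → ℤ
evalA e Σ' = evalE e (λ { (j , y) → Σ' j y })

HoldsAt : ℕ → BExp → GState → Set
HoldsAt i b Σ' = evalB b (Σ' i) ≡ true

FailsAt : ℕ → BExp → GState → Set
FailsAt i b Σ' = evalB b (Σ' i) ≡ false

-- Existential quantification of the indexed variables satisfying S:
-- some state agreeing with Σ' off S satisfies Φ.
ExistsVars : (ℕ → ℕ → Set) → Assertion → Assertion
ExistsVars S Φ Σ' = Σ[ Σ₀ ∈ GState ] Φ Σ₀ × (∀ j y → ¬ S j y → Σ₀ j y ≡ Σ' j y)

ExistsVar : ℕ → ℕ → Assertion → Assertion
ExistsVar i x = ExistsVars (λ j y → (j ≡ i) × (y ≡ x))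

ExistsMod : ℕ → Prog → Assertion → Assertion
ExistsMod i P = ExistsVars (λ j y → (j ≡ i) × (y ∈ mod P))

Top : Assertion
Top _ = Data.Unit.⊤
  where import Data.Unit

-- Hoare triples {Φ} P {Φ'} and under-approximate triples [Φ] P [Φ'],
-- with P operating on the copy 𝒱_i and assertions over all copies.

HoareValid : ℕ → Assertion → Prog → Assertion → Set
HoareValid i Φ P Φ' = ∀ Σ' s → Φ Σ' → Exec P (Σ' i) s → Φ' (upd Σ' i s)

UnderValid : ℕ → Assertion → Prog → Assertion → Set
UnderValid i Φ P Φ' = ∀ Σ' → Φ Σ' → Σ[ s ∈ Store ] Exec P (Σ' i) s × Φ' (upd Σ' i s)

-- Abstract proof systems for the two kinds of triples (judgments ⊢).
ProofSystem : Set₂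
ProofSystem = ℕ → Assertion → Prog → Assertion → Set₁

-- FEHTs.  A program list is a list of pairs (i , P): P operates on 𝒱_i.

IProg : Set
IProg = ℕ × Prog

-- Sequential execution of a list of indexed programs; the final state
-- is determined up to pointwise equality.
ExecL : List IProg → GState → GState → Set
ExecL [] Σ' Σ'' = ∀ j y → Σ'' j y ≡ Σ' j y
ExecL ((i , P) ∷ L) Σ' Σ'' = Σ[ s ∈ Store ] Exec P (Σ' i) s × ExecL L (upd Σ' i s) Σ''

ValidFEHT : Assertion → List IProg → List IProg → Assertion → Set
ValidFEHT Φ U E Ψ =
  ∀ Σ₀ → Φ Σ₀ → ∀ Σ₁ → ExecL U Σ₀ Σ₁ →
  Σ[ Σ₂ ∈ GState ] ExecL E Σ₁ Σ₂ × Ψ Σ₂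

-- Loops for the loop rule: while(b, P) ; Q  on copy idx, with count cnt.

record LoopProg : Set where
  constructor mkLoop
  field
    idx   : ℕ
    guard : BExp
    body  : Prog
    rest  : Prog
    cnt   : ℕ
open LoopProg public

whileOf : LoopProg → IProg
whileOf r = idx r , (while (guard r) (body r) ⨾ rest r)

bodyOf : LoopProg → IProg
bodyOf r = idx r , body r

restOf : LoopProg → IProg
restOf r = idx r , rest r

GuardsT : List LoopProg → Assertion
GuardsT L Σ' = All (λ r → HoldsAt (idx r) (guard r) Σ') L

GuardsF : List LoopProg → Assertion
GuardsF L Σ' = All (λ r → FailsAt (idx r) (guard r) Σ') L

activeIn : ℕ → List LoopProg → List LoopProg
activeIn j = filterᵇ (λ r → j ℕ.≤ᵇ cnt r)

runningAfter : ℕ → List LoopProg → List LoopProg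
runningAfter j = filterᵇ (λ r → suc j ℕ.≤ᵇ cnt r)

module FEHL (⊢H : ProofSystem) (⊢U : ProofSystem) where

  infix 2 ⊢_⟨_⟩⟨_⟩_

  data ⊢_⟨_⟩⟨_⟩_ : Assertion → List IProg → List IProg → Assertion → Set₂ where
    reorder∀ : ∀ {Φ Ψ U U' E} → U ↭ U' → ⊢ Φ ⟨ U' ⟩⟨ E ⟩ Ψ → ⊢ Φ ⟨ U ⟩⟨ E ⟩ Ψ
    reorder∃ : ∀ {Φ Ψ U E E'} → E ↭ E' → ⊢ Φ ⟨ U ⟩⟨ E' ⟩ Ψ → ⊢ Φ ⟨ U ⟩⟨ E ⟩ Ψ
    seqSkip∀ : ∀ {Φ Ψ U E i P} → ⊢ Φ ⟨ (i , P ⨾ skip) ∷ U ⟩⟨ E ⟩ Ψ → ⊢ Φ ⟨ (i , P) ∷ U ⟩⟨ E ⟩ Ψ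
    seqSkip∃ : ∀ {Φ Ψ U E i P} → ⊢ Φ ⟨ U ⟩⟨ (i , P ⨾ skip) ∷ E ⟩ Ψ → ⊢ Φ ⟨ U ⟩⟨ (i , P) ∷ E ⟩ Ψ
    elimSkip∀ : ∀ {Φ Ψ U E i} → ⊢ Φ ⟨ U ⟩⟨ E ⟩ Ψ → ⊢ Φ ⟨ (i , skip) ∷ U ⟩⟨ E ⟩ Ψ
    elimSkip∃ : ∀ {Φ Ψ U E i} → ⊢ Φ ⟨ U ⟩⟨ E ⟩ Ψ → ⊢ Φ ⟨ U ⟩⟨ (i , skip) ∷ E ⟩ Ψ
    assoc∀ : ∀ {Φ Ψ U E i P₁ P₂ P₃} → ⊢ Φ ⟨ (i , P₁ ⨾ (P₂ ⨾ P₃)) ∷ U ⟩⟨ E ⟩ Ψ →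
             ⊢ Φ ⟨ (i , (P₁ ⨾ P₂) ⨾ P₃) ∷ U ⟩⟨ E ⟩ Ψ
    assoc∃ : ∀ {Φ Ψ U E i P₁ P₂ P₃} → ⊢ Φ ⟨ U ⟩⟨ (i , P₁ ⨾ (P₂ ⨾ P₃)) ∷ E ⟩ Ψ →
             ⊢ Φ ⟨ U ⟩⟨ (i , (P₁ ⨾ P₂) ⨾ P₃) ∷ E ⟩ Ψ
    done : ∀ {Φ} → ⊢ Φ ⟨ [] ⟩⟨ [] ⟩ Φ
    cons : ∀ {Φ Φ' Ψ Ψ' U E} → (∀ Σ' → Φ Σ' → Φ' Σ') → ⊢ Φ' ⟨ U ⟩⟨ E ⟩ Ψ' →
           (∀ Σ' → Ψ' Σ' → Ψ Σ') → ⊢ Φ ⟨ U ⟩⟨ E ⟩ Ψ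
    if∀ : ∀ {Φ Ψ U E i b P₁ P₂ P₃} →
          ⊢ (λ Σ' → Φ Σ' × HoldsAt i b Σ') ⟨ (i , P₁ ⨾ P₃) ∷ U ⟩⟨ E ⟩ Ψ →
          ⊢ (λ Σ' → Φ Σ' × FailsAt i b Σ') ⟨ (i , P₂ ⨾ P₃) ∷ U ⟩⟨ E ⟩ Ψ →
          ⊢ Φ ⟨ (i , if′ b P₁ P₂ ⨾ P₃) ∷ U ⟩⟨ E ⟩ Ψ
    if∃ : ∀ {Φ Ψ U E i b P₁ P₂ P₃} →
          ⊢ (λ Σ' → Φ Σ' × HoldsAt i b Σ') ⟨ U ⟩⟨ (i , P₁ ⨾ P₃) ∷ E ⟩ Ψ →
          ⊢ (λ Σ' → Φ Σ' × FailsAt i b Σ') ⟨ U ⟩⟨ (i , P₂ ⨾ P₃) ∷ E ⟩ Ψ →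
          ⊢ Φ ⟨ U ⟩⟨ (i , if′ b P₁ P₂ ⨾ P₃) ∷ E ⟩ Ψ
    step∀ : ∀ {Φ Φ' Ψ U E i P₁ P₂} → ⊢H i Φ P₁ Φ' →
            ⊢ Φ' ⟨ (i , P₂) ∷ U ⟩⟨ E ⟩ Ψ → ⊢ Φ ⟨ (i , P₁ ⨾ P₂) ∷ U ⟩⟨ E ⟩ Ψ
    step∃ : ∀ {Φ Φ' Ψ U E i P₁ P₂} → ⊢U i Φ P₁ Φ' →
            ⊢ Φ' ⟨ U ⟩⟨ (i , P₂) ∷ E ⟩ Ψ → ⊢ Φ ⟨ U ⟩⟨ (i , P₁ ⨾ P₂) ∷ E ⟩ Ψ
    assume∀ : ∀ {Φ Ψ U E i b P} →
              ⊢ (λ Σ' → Φ Σ' × HoldsAt i b Σ') ⟨ (i , P) ∷ U ⟩⟨ E ⟩ Ψ →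
              ⊢ Φ ⟨ (i , assume b ⨾ P) ∷ U ⟩⟨ E ⟩ Ψ
    assume∃ : ∀ {Φ Ψ U E i b P} → (∀ Σ' → Φ Σ' → HoldsAt i b Σ') →
              ⊢ Φ ⟨ U ⟩⟨ (i , P) ∷ E ⟩ Ψ →
              ⊢ Φ ⟨ U ⟩⟨ (i , assume b ⨾ P) ∷ E ⟩ Ψ
    choice∀ : ∀ {Φ Ψ U E i x P} →
              ⊢ ExistsVar i x Φ ⟨ (i , P) ∷ U ⟩⟨ E ⟩ Ψ →
              ⊢ Φ ⟨ (i , (x ≔⋆) ⨾ P) ∷ U ⟩⟨ E ⟩ Ψ
    choice∃ : ∀ {Φ Ψ U E i x P} (e : Exp (ℕ × ℕ)) → (i , x) ∉ vars e →
              ⊢ (λ Σ' → ExistsVar i x Φ Σ' × Σ' i x ≡ evalA e Σ') ⟨ U ⟩⟨ (i , P) ∷ E ⟩ Ψ →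
              ⊢ Φ ⟨ U ⟩⟨ (i , (x ≔⋆) ⨾ P) ∷ E ⟩ Ψ
    havoc∀ : ∀ {Φ Ψ U E i P} → ⊢ ExistsMod i P Φ ⟨ U ⟩⟨ E ⟩ Ψ →
             ⊢ Φ ⟨ (i , P) ∷ U ⟩⟨ E ⟩ Ψ
    havoc∃ : ∀ {Φ Ψ U E i P} → ⊢U i Φ P Top → ⊢ ExistsMod i P Φ ⟨ U ⟩⟨ E ⟩ Ψ →
             ⊢ Φ ⟨ U ⟩⟨ (i , P) ∷ E ⟩ Ψ
    loop : ∀ {Φ Ψ} (LU LE : List LoopProg) (I : Assertion) (B : ℕ) (Is : ℕ → Assertion) →
           LU ≢ [] →
           All (λ r → 1 ℕ.≤ cnt r × cnt r ℕ.≤ B) (LU ++ LE) →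
           Is 1 ≡ I → Is (suc B) ≡ I →
           (∀ Σ' → Φ Σ' → I Σ') →
           (∀ Σ' → I Σ' → GuardsT (LU ++ LE) Σ' ⊎ GuardsF (LU ++ LE) Σ') →
           (∀ j → 1 ℕ.≤ j → j ℕ.≤ B →
              ⊢ (λ Σ' → Is j Σ' × GuardsT (activeIn j LU ++ activeIn j LE) Σ')
                ⟨ map bodyOf (activeIn j LU) ⟩⟨ map bodyOf (activeIn j LE) ⟩
                (λ Σ' → Is (suc j) Σ' × GuardsT (runningAfter j LU ++ runningAfter j LE) Σ')) →
           ⊢ (λ Σ' → I Σ' × GuardsF (LU ++ LE) Σ') ⟨ map restOf LU ⟩⟨ map restOf LE ⟩ Ψ →
           ⊢ Φ ⟨ map whileOf LU ⟩⟨ map whileOf LE ⟩ Ψ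

{-# OPTIONS --safe #-}
module Submission where

-- The programs of a tuple act on distinct copies 𝒱_i, so running them one after the other
-- (ExecL) is the same as running every copy on its own; validity is proved in this
-- componentwise form, where every rule but the loop rule touches a single component.
-- For the loop rule, the terminated universal loops all finish within some number M of
-- iterations, and one pass through the B rounds performs at least one iteration of each of
-- them (all counts are ≥ 1); so after at most M passes all guards are false and the
-- suffixes take over. The existential loops are assembled backwards: every round prepends
-- one iteration to whatever the later rounds produce.

open import Defs
open import Data.Product using (proj₁)
open import Data.List using (List; map; _++_)
open import Data.List.Relation.Unary.Unique.Propositional using (Unique)

open import Data.Bool using (Bool; true; false; if_then_else_; not; _∧_; _∨_; T)
open import Data.Bool.Properties using (not-injective; not-¬)
open import Data.Empty using (⊥-elim)
open import Data.Integer as ℤ using (ℤ)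
open import Data.List using ([]; _∷_; filterᵇ)
open import Data.List.Properties using (map-++; map-∘; filter-++)
open import Data.List.Membership.Propositional using (_∈_; _∉_)
open import Data.List.Membership.Propositional.Properties
  using (∈-map⁺; ∈-map⁻; ∈-++⁺ˡ; ∈-++⁺ʳ; ∈-filter⁺; ∈-filter⁻)
open import Data.List.Relation.Binary.Permutation.Propositional using (_↭_; ↭-sym; ↭⇒↭ₛ)
open import Data.List.Relation.Binary.Permutation.Propositional.Properties
  using (∈-resp-↭; ++⁺ʳ; ++⁺ˡ; shift) renaming (map⁺ to ↭-map⁺)
open import Data.List.Relation.Unary.All as All using (All)
open import Data.List.Relation.Unary.All.Properties as Allₚ using (All¬⇒¬Any)
open import Data.List.Relation.Unary.AllPairs using (_∷_; [])
import Data.List.Relation.Unary.AllPairs.Properties as AllPairs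
open import Data.List.Relation.Unary.Any using (here; there)
open import Data.List.Relation.Unary.Unique.Propositional.Properties using (Unique[x∷xs]⇒x∉xs)
open import Data.Nat using (ℕ; zero; suc; _≤_; _<_; _+_; _⊔_; _≤ᵇ_; _≡ᵇ_; _≟_; z≤n; s≤s)
open import Data.Nat.Properties
  using (≡ᵇ⇒≡; ≡⇒≡ᵇ; ≤ᵇ⇒≤; ≤⇒≤ᵇ; ≤-refl; ≤-reflexive; n≤1+n; m≤n+m; m≤m⊔n; m≤n⊔m; <⇒≱;
         +-suc; +-comm; suc-injective)
open import Data.List.Membership.DecPropositional _≟_ using (_∈?_)
open import Data.Product using (Σ-syntax; ∃; ∃-syntax; _×_; _,_; proj₂)
open import Data.Sum using (_⊎_; inj₁; inj₂)
open import Data.Unit using (tt)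
open import Function using (_∘_)
open import Relation.Binary.Bundles using (Setoid)
open import Relation.Binary.PropositionalEquality
  using (_≡_; _≢_; _≗_; refl; sym; trans; cong; cong₂; cong-app; subst; subst₂; setoid; _→-setoid_)
open import Relation.Nullary using (¬_; yes; no)
open import Relation.Nullary.Decidable using (⌊_⌋; T?)
open import Data.List.Relation.Binary.Permutation.Setoid.Properties (setoid ℕ) using (Unique-resp-↭)

open Setoid (ℕ →-setoid ℤ) using () renaming (refl to ≗-refl; sym to ≗-sym; trans to ≗-trans)

if-≡ᵇ-refl : ∀ {a} {A : Set a} i {x y : A} → (if i ≡ᵇ i then x else y) ≡ x
if-≡ᵇ-refl i with i ≡ᵇ i | ≡⇒≡ᵇ i i refl
... | true | _ = refl

if-≡ᵇ-≢ : ∀ {a} {A : Set a} {k i} {x y : A} → k ≢ i → (if k ≡ᵇ i then x else y) ≡ y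
if-≡ᵇ-≢ {k = k} {i} k≢i with k ≡ᵇ i | ≡ᵇ⇒≡ k i
... | false | _   = refl
... | true  | k≡i = ⊥-elim (k≢i (k≡i tt))

set-cong : ∀ {s s' : Store} {x v v'} → s ≗ s' → v ≡ v' → set s x v ≗ set s' x v'
set-cong {x = x} s≗s' refl y with y ≡ᵇ x
... | true  = refl
... | false = s≗s' y

upd-agrees : ∀ (G : GState) i {t : Store} {S : ℕ → Set} → (∀ y → ¬ S y → t y ≡ G i y) →
             ∀ j y → ¬ (j ≡ i × S y) → G j y ≡ upd G i t j y
upd-agrees G i frame j y outside with j ≟ i
... | yes refl = sym (trans (cong-app (if-≡ᵇ-refl j) y) (frame y (λ Sy → outside (refl , Sy))))
... | no j≢i   = sym (cong-app (if-≡ᵇ-≢ j≢i) y)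

evalE-local : ∀ {V : Set} (e : Exp V) {s s' : V → ℤ} → (∀ v → v ∈ vars e → s v ≡ s' v) →
              evalE e s ≡ evalE e s'
evalE-local (const _) _ = refl
evalE-local (var x)   h = h x (here refl)
evalE-local (a ⊕ b)   h =
  cong₂ ℤ._+_ (evalE-local a (λ v → h v ∘ ∈-++⁺ˡ)) (evalE-local b (λ v → h v ∘ ∈-++⁺ʳ (vars a)))
evalE-local (a ⊖ b)   h =
  cong₂ ℤ._-_ (evalE-local a (λ v → h v ∘ ∈-++⁺ˡ)) (evalE-local b (λ v → h v ∘ ∈-++⁺ʳ (vars a)))
evalE-local (a ⊛ b)   h =
  cong₂ ℤ._*_ (evalE-local a (λ v → h v ∘ ∈-++⁺ˡ)) (evalE-local b (λ v → h v ∘ ∈-++⁺ʳ (vars a)))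

evalE-cong : ∀ {V : Set} (e : Exp V) {s s' : V → ℤ} → s ≗ s' → evalE e s ≡ evalE e s'
evalE-cong e s≗s' = evalE-local e (λ v _ → s≗s' v)

evalB-cong : ∀ b {s s'} → s ≗ s' → evalB b s ≡ evalB b s'
evalB-cong tt         _ = refl
evalB-cong ff         _ = refl
evalB-cong (bnot b)   h = cong not (evalB-cong b h)
evalB-cong (band a b) h = cong₂ _∧_ (evalB-cong a h) (evalB-cong b h)
evalB-cong (bor a b)  h = cong₂ _∨_ (evalB-cong a h) (evalB-cong b h)
evalB-cong (beq a b)  h = cong₂ (λ x y → ⌊ x ℤ.≟ y ⌋) (evalE-cong a h) (evalE-cong b h)
evalB-cong (ble a b)  h = cong₂ ℤ._≤ᵇ_ (evalE-cong a h) (evalE-cong b h)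
evalB-cong (blt a b)  h = cong₂ (λ x y → ⌊ x ℤ.<? y ⌋) (evalE-cong a h) (evalE-cong b h)

guard-cong : ∀ b {s s' β} → s ≗ s' → evalB b s ≡ β → evalB b s' ≡ β
guard-cong b s≗s' g = trans (sym (evalB-cong b s≗s')) g

-- Stores are functions, so ExecL fixes final stores only up to ≗.
Exec≗ : Prog → Store → Store → Set
Exec≗ P s t = Σ[ t' ∈ Store ] Exec P s t' × t' ≗ t

Exec≗-skip : ∀ {s t} → s ≗ t → Exec≗ skip s t
Exec≗-skip s≗t = _ , ex-skip , s≗t

skip-≗ : ∀ {s t} → Exec≗ skip s t → s ≗ t
skip-≗ (_ , ex-skip , s≗t) = s≗t

exec-cong : ∀ {P s s' t} → s ≗ s' → Exec P s t → Exec≗ P s' t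
exec-cong h ex-skip = _ , ex-skip , ≗-sym h
exec-cong {x ≔ e} h ex-assign = _ , ex-assign , set-cong (≗-sym h) (sym (evalE-cong e h))
exec-cong {assume b} h (ex-assume g) = _ , ex-assume (guard-cong b h g) , ≗-sym h
exec-cong {if′ b _ _} h (ex-ifT g e) with exec-cong h e
... | t , e' , t≗ = t , ex-ifT (guard-cong b h g) e' , t≗
exec-cong {if′ b _ _} h (ex-ifF g e) with exec-cong h e
... | t , e' , t≗ = t , ex-ifF (guard-cong b h g) e' , t≗
exec-cong {while b _} h (ex-whileT g e w) with exec-cong h e
... | m , e' , m≗ with exec-cong (≗-sym m≗) w
... | t , w' , t≗ = t , ex-whileT (guard-cong b h g) e' w' , t≗
exec-cong {while b _} h (ex-whileF g) = _ , ex-whileF (guard-cong b h g) , ≗-sym h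
exec-cong h (ex-seq e₁ e₂) with exec-cong h e₁
... | m , e₁' , m≗ with exec-cong (≗-sym m≗) e₂
... | t , e₂' , t≗ = t , ex-seq e₁' e₂' , t≗
exec-cong h (ex-havoc v) = _ , ex-havoc v , set-cong (≗-sym h) refl

Exec≗-cong : ∀ {P s s' t t'} → s ≗ s' → t ≗ t' → Exec≗ P s t → Exec≗ P s' t'
Exec≗-cong s≗s' t≗t' (m , e , m≗t) with exec-cong s≗s' e
... | m' , e' , m'≗m = m' , e' , ≗-trans m'≗m (≗-trans m≗t t≗t')

Exec≗-seq : ∀ {P Q s m t} → Exec≗ P s m → Exec≗ Q m t → Exec≗ (P ⨾ Q) s t
Exec≗-seq (m' , e , m'≗m) q with Exec≗-cong (≗-sym m'≗m) ≗-refl q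
... | t' , e' , t'≗t = t' , ex-seq e e' , t'≗t

exec-frame : ∀ {P s t} → Exec P s t → ∀ y → y ∉ mod P → t y ≡ s y
exec-frame ex-skip                _ _  = refl
exec-frame ex-assign              _ y∉ = if-≡ᵇ-≢ (y∉ ∘ here)
exec-frame (ex-assume _)          _ _  = refl
exec-frame (ex-ifT _ e)           y y∉ = exec-frame e y (y∉ ∘ ∈-++⁺ˡ)
exec-frame {if′ _ P _} (ex-ifF _ e) y y∉ = exec-frame e y (y∉ ∘ ∈-++⁺ʳ (mod P))
exec-frame (ex-whileT _ e w)      y y∉ = trans (exec-frame w y y∉) (exec-frame e y y∉)
exec-frame (ex-whileF _)          _ _  = refl
exec-frame {P ⨾ _} (ex-seq e₁ e₂) y y∉ =
  trans (exec-frame e₂ y (y∉ ∘ ∈-++⁺ʳ (mod P))) (exec-frame e₁ y (y∉ ∘ ∈-++⁺ˡ))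
exec-frame (ex-havoc _)           _ y∉ = if-≡ᵇ-≢ (y∉ ∘ here)

infix 4 _⊑_

_⊑_ : Prog → Prog → Set
P ⊑ Q = ∀ {s t} → Exec P s t → Exec Q s t

Exec≗-⊑ : ∀ {P Q s t} → P ⊑ Q → Exec≗ P s t → Exec≗ Q s t
Exec≗-⊑ P⊑Q (t' , e , t'≗t) = t' , P⊑Q e , t'≗t

⨾-monoˡ-⊑ : ∀ {P P' Q} → P ⊑ P' → (P ⨾ Q) ⊑ (P' ⨾ Q)
⨾-monoˡ-⊑ P⊑P' (ex-seq e₁ e₂) = ex-seq (P⊑P' e₁) e₂

⨾-skip⁺ : ∀ {P} → P ⊑ (P ⨾ skip)
⨾-skip⁺ e = ex-seq e ex-skip

⨾-skip⁻ : ∀ {P} → (P ⨾ skip) ⊑ P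
⨾-skip⁻ (ex-seq e ex-skip) = e

⨾-assoc⁺ : ∀ {P Q R} → ((P ⨾ Q) ⨾ R) ⊑ (P ⨾ (Q ⨾ R))
⨾-assoc⁺ (ex-seq (ex-seq e₁ e₂) e₃) = ex-seq e₁ (ex-seq e₂ e₃)

⨾-assoc⁻ : ∀ {P Q R} → (P ⨾ (Q ⨾ R)) ⊑ ((P ⨾ Q) ⨾ R)
⨾-assoc⁻ (ex-seq e₁ (ex-seq e₂ e₃)) = ex-seq (ex-seq e₁ e₂) e₃

bounded : BExp → Prog → ℕ → Prog
bounded b P zero    = assume (bnot b)
bounded b P (suc n) = if′ b (P ⨾ bounded b P n) skip

while⇒bounded : ∀ {b P s t} → Exec (while b P) s t → ∃[ n ] Exec (bounded b P n) s t
while⇒bounded (ex-whileT g e w) with while⇒bounded w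
... | n , w' = suc n , ex-ifT g (ex-seq e w')
while⇒bounded (ex-whileF g) = zero , ex-assume (cong not g)

bounded-mono : ∀ {b P m n} → m ≤ n → bounded b P m ⊑ bounded b P n
bounded-mono {n = zero}  z≤n       e                       = e
bounded-mono {n = suc n} z≤n       (ex-assume g)           = ex-ifF (not-injective {y = false} g) ex-skip
bounded-mono             (s≤s m≤n) (ex-ifT g (ex-seq e r)) = ex-ifT g (ex-seq e (bounded-mono m≤n r))
bounded-mono             (s≤s m≤n) (ex-ifF g ex-skip)      = ex-ifF g ex-skip

module _ {b : BExp} {P Q : Prog} where

  while⇒pending : ∀ {s u} → Exec≗ (while b P ⨾ Q) s u → ∃[ n ] Exec≗ (bounded b P n ⨾ Q) s u
  while⇒pending (t , ex-seq w q , t≗u) with while⇒bounded w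
  ... | n , w' = n , t , ex-seq w' q , t≗u

  pending-mono : ∀ {m n s u} → m ≤ n → Exec≗ (bounded b P m ⨾ Q) s u → Exec≗ (bounded b P n ⨾ Q) s u
  pending-mono m≤n = Exec≗-⊑ (⨾-monoˡ-⊑ (bounded-mono m≤n))

  pending-zero : ∀ {s u} → evalB b s ≡ true → ¬ Exec≗ (bounded b P 0 ⨾ Q) s u
  pending-zero g (_ , ex-seq (ex-assume g') _ , _) = not-¬ g (not-injective {y = false} g')

  pending-peel : ∀ {n s u} → evalB b s ≡ true → Exec≗ (bounded b P (suc n) ⨾ Q) s u →
                 ∃[ m ] Exec P s m × Exec≗ (bounded b P n ⨾ Q) m u
  pending-peel _ (t , ex-seq (ex-ifT _ (ex-seq e r)) q , t≗u) = _ , e , t , ex-seq r q , t≗u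
  pending-peel g (_ , ex-seq (ex-ifF g' _) _ , _)            = ⊥-elim (not-¬ g g')

  pending-exit : ∀ {n s u} → evalB b s ≡ false → Exec≗ (bounded b P n ⨾ Q) s u → Exec≗ Q s u
  pending-exit {zero}  _ (t , ex-seq (ex-assume _) q , t≗u)      = t , q , t≗u
  pending-exit {suc n} _ (t , ex-seq (ex-ifF _ ex-skip) q , t≗u) = t , q , t≗u
  pending-exit {suc n} g (_ , ex-seq (ex-ifT g' _) _ , _)        = ⊥-elim (not-¬ g' g)

  while-exit : ∀ {s v} → evalB b s ≡ false → Exec≗ Q s v → Exec≗ (while b P ⨾ Q) s v
  while-exit g (t , q , t≗v) = t , ex-seq (ex-whileF g) q , t≗v

  while-unfold : ∀ {s m v} → evalB b s ≡ true → Exec≗ P s m → Exec≗ (while b P ⨾ Q) m v →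
                 Exec≗ (while b P ⨾ Q) s v
  while-unfold g (m' , e , m'≗m) w with Exec≗-cong (≗-sym m'≗m) ≗-refl w
  ... | t , ex-seq w' q , t≗v = t , ex-seq (ex-whileT g e w') q , t≗v

ExistsVars-upd : ∀ {Φ : Assertion} {G i t} {S : ℕ → Set} → (∀ y → ¬ S y → t y ≡ G i y) → Φ G →
                 ExistsVars (λ j y → j ≡ i × S y) Φ (upd G i t)
ExistsVars-upd {G = G} {i} frame φ = G , φ , upd-agrees G i frame

havoc-hoare : ∀ {i Φ P} → HoareValid i Φ P (ExistsMod i P Φ)
havoc-hoare _ _ φ e = ExistsVars-upd (exec-frame e) φ

choice-hoare : ∀ {i Φ x} → HoareValid i Φ (x ≔⋆) (ExistsVar i x Φ)
choice-hoare _ _ φ (ex-havoc _) = ExistsVars-upd (λ _ → if-≡ᵇ-≢) φ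

havoc-under : ∀ {i Φ P Φ'} → UnderValid i Φ P Φ' → UnderValid i Φ P (ExistsMod i P Φ)
havoc-under under G φ with under G φ
... | t , e , _ = t , e , havoc-hoare G t φ e

choice-under : ∀ {i Φ x} (e : Exp (ℕ × ℕ)) → (i , x) ∉ vars e →
               UnderValid i Φ (x ≔⋆) (λ G → ExistsVar i x Φ G × G i x ≡ evalA e G)
choice-under {i} {x = x} e x∉ G φ = w , ex-havoc v , choice-hoare G w φ (ex-havoc v) , chosen
  where
    v : ℤ
    v = evalA e G
    w : Store
    w = set (G i) x v
    unchanged : ∀ p → p ∈ vars e → G (proj₁ p) (proj₂ p) ≡ upd G i w (proj₁ p) (proj₂ p)
    unchanged (j , y) jy∈ = upd-agrees G i {S = _≡ x} (λ _ → if-≡ᵇ-≢) j y (λ { (refl , refl) → x∉ jy∈ })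
    chosen : upd G i w i x ≡ evalA e (upd G i w)
    chosen = trans (cong-app (if-≡ᵇ-refl i) x) (trans (if-≡ᵇ-refl x) (evalE-local e unchanged))

Family : Set
Family = ℕ → Prog

_[_↦_] : Family → ℕ → Prog → Family
(F [ i ↦ P ]) k = if k ≡ᵇ i then P else F k

⟦_⟧ : List IProg → Family
⟦ [] ⟧        _ = skip
⟦ (i , P) ∷ L ⟧ = ⟦ L ⟧ [ i ↦ P ]

Runs : Family → GState → GState → Set
Runs F G G' = ∀ k → Exec≗ (F k) (G k) (G' k)

Valid : Assertion → Family → Family → Assertion → Set
Valid Φ FU FE Ψ = ∀ G₀ → Φ G₀ → ∀ G₁ → Runs FU G₀ G₁ → Σ[ G₂ ∈ GState ] Runs FE G₁ G₂ × Ψ G₂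

[↦]-idle : ∀ {F i} → F i ≡ skip → ∀ k → (F [ i ↦ skip ]) k ≡ F k
[↦]-idle {i = i} idle k with k ≟ i
... | yes refl = trans (if-≡ᵇ-refl k) (sym idle)
... | no k≢i   = if-≡ᵇ-≢ k≢i

Runs-cong : ∀ {F F' G G'} → (∀ k → F k ≡ F' k) → Runs F G G' → Runs F' G G'
Runs-cong F≡F' R k = subst (λ P → Exec≗ P _ _) (F≡F' k) (R k)

Runs-at : ∀ {F i P G G'} → Runs (F [ i ↦ P ]) G G' → Exec≗ P (G i) (G' i)
Runs-at {i = i} R = subst (λ P → Exec≗ P _ _) (if-≡ᵇ-refl i) (R i)

Runs-idle : ∀ {F i G G'} → F i ≡ skip → Runs F G G' → G i ≗ G' i
Runs-idle idle R = skip-≗ (subst (λ P → Exec≗ P _ _) idle (R _))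

Runs-replace : ∀ {F i P Q G H G'} → Runs (F [ i ↦ P ]) G G' → (∀ k → k ≢ i → H k ≡ G k) →
               Exec≗ Q (H i) (G' i) → Runs (F [ i ↦ Q ]) H G'
Runs-replace {i = i} R agree q k with k ≟ i
... | yes refl = subst (λ P → Exec≗ P _ _) (sym (if-≡ᵇ-refl k)) q
... | no k≢i   = subst₂ (λ P s → Exec≗ P s _) (sym (if-≡ᵇ-≢ k≢i)) (sym (agree k k≢i))
                   (subst (λ P → Exec≗ P _ _) (if-≡ᵇ-≢ k≢i) (R k))

Runs-set : ∀ {F i P Q G G'} → Runs (F [ i ↦ P ]) G G' → Exec≗ Q (G i) (G' i) →
           Runs (F [ i ↦ Q ]) G G'
Runs-set R = Runs-replace R (λ _ _ → refl)

Runs-shift : ∀ {F i P Q G G' s} → Runs (F [ i ↦ P ]) G G' → Exec≗ Q s (G' i) →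
             Runs (F [ i ↦ Q ]) (upd G i s) G'
Runs-shift {i = i} R q =
  Runs-replace R (λ _ → if-≡ᵇ-≢) (subst (λ s → Exec≗ _ s _) (sym (if-≡ᵇ-refl i)) q)

Runs-unshift : ∀ {F i P Q G G' s} → Runs (F [ i ↦ P ]) (upd G i s) G' → Exec≗ Q (G i) (G' i) →
               Runs (F [ i ↦ Q ]) G G'
Runs-unshift R = Runs-replace R (λ _ → sym ∘ if-≡ᵇ-≢)

Runs-upd : ∀ {F i G G' s} → F i ≡ skip → Runs F G G' → Runs F (upd G i s) (upd G' i s)
Runs-upd {F} {i} {s = s} idle R k with k ≟ i
... | yes refl = subst₂ (Exec≗ (F k)) (sym (if-≡ᵇ-refl k)) (sym (if-≡ᵇ-refl k))
                   (subst (λ P → Exec≗ P s s) (sym idle) (Exec≗-skip ≗-refl))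
... | no k≢i   = subst₂ (Exec≗ (F k)) (sym (if-≡ᵇ-≢ k≢i)) (sym (if-≡ᵇ-≢ k≢i)) (R k)

module _ {Φ Ψ : Assertion} where

  Valid-cong : ∀ {FU FU' FE FE'} → (∀ k → FU k ≡ FU' k) → (∀ k → FE k ≡ FE' k) →
               Valid Φ FU FE Ψ → Valid Φ FU' FE' Ψ
  Valid-cong FU≡ FE≡ valid G₀ φ G₁ R with valid G₀ φ G₁ (Runs-cong (sym ∘ FU≡) R)
  ... | G₂ , R₂ , ψ = G₂ , Runs-cong FE≡ R₂ , ψ

  Valid-idle∀ : ∀ {F FE i} → F i ≡ skip → Valid Φ F FE Ψ → Valid Φ (F [ i ↦ skip ]) FE Ψ
  Valid-idle∀ idle = Valid-cong (sym ∘ [↦]-idle idle) (λ _ → refl)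

  Valid-idle∃ : ∀ {FU F i} → F i ≡ skip → Valid Φ FU F Ψ → Valid Φ FU (F [ i ↦ skip ]) Ψ
  Valid-idle∃ idle = Valid-cong (λ _ → refl) (sym ∘ [↦]-idle idle)

  Valid-⊑∀ : ∀ {F FE i P Q} → P ⊑ Q → Valid Φ (F [ i ↦ Q ]) FE Ψ → Valid Φ (F [ i ↦ P ]) FE Ψ
  Valid-⊑∀ P⊑Q valid G₀ φ G₁ R = valid G₀ φ G₁ (Runs-set R (Exec≗-⊑ P⊑Q (Runs-at R)))

  Valid-⊑∃ : ∀ {FU F i P Q} → P ⊑ Q → Valid Φ FU (F [ i ↦ P ]) Ψ → Valid Φ FU (F [ i ↦ Q ]) Ψ
  Valid-⊑∃ P⊑Q valid G₀ φ G₁ R with valid G₀ φ G₁ R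
  ... | G₂ , R₂ , ψ = G₂ , Runs-set R₂ (Exec≗-⊑ P⊑Q (Runs-at R₂)) , ψ

  Valid-guarded∃ : ∀ {FU F i β P Q} b → FU i ≡ skip → (∀ G → Φ G → evalB b (G i) ≡ β) →
                   (∀ {s t} → evalB b s ≡ β → Exec P s t → Exec Q s t) →
                   Valid Φ FU (F [ i ↦ P ]) Ψ → Valid Φ FU (F [ i ↦ Q ]) Ψ
  Valid-guarded∃ b idle guard refine valid G₀ φ G₁ R with valid G₀ φ G₁ R
  ... | G₂ , R₂ , ψ with Runs-at R₂
  ... | t , e , t≗ = G₂ , Runs-set R₂ (t , refine guard₁ e , t≗) , ψ
    where
      guard₁ : evalB b (G₁ _) ≡ _
      guard₁ = guard-cong b (Runs-idle idle R) (guard G₀ φ)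

  Valid-prefix∀ : ∀ {Φ' F FE i P Q} → HoareValid i Φ P Φ' → Valid Φ' (F [ i ↦ Q ]) FE Ψ →
                  Valid Φ (F [ i ↦ P ⨾ Q ]) FE Ψ
  Valid-prefix∀ hoare valid G₀ φ G₁ R with Runs-at R
  ... | t , ex-seq {t = m} e₁ e₂ , t≗ =
    valid (upd G₀ _ m) (hoare G₀ m φ e₁) G₁ (Runs-shift R (t , e₂ , t≗))

  Valid-prefix∃ : ∀ {Φ' FU F i P Q} → FU i ≡ skip → UnderValid i Φ P Φ' →
                  Valid Φ' FU (F [ i ↦ Q ]) Ψ → Valid Φ FU (F [ i ↦ P ⨾ Q ]) Ψ
  Valid-prefix∃ {i = i} idle under valid G₀ φ G₁ R with under G₀ φ
  ... | m , e₁ , φ' with valid (upd G₀ i m) φ' (upd G₁ i m) (Runs-upd idle R)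
  ... | G₂ , R₂ , ψ = G₂ , Runs-unshift R₂ (Exec≗-seq (exec-cong (Runs-idle idle R) e₁) rest₂) , ψ
    where
      rest₂ : Exec≗ _ m (G₂ i)
      rest₂ = subst (λ s → Exec≗ _ s _) (if-≡ᵇ-refl i) (Runs-at R₂)

Respond : Prog → Prog → Store → (Store → Set) → Set
Respond P Q s Goal = Σ[ s₁ ∈ Store ] Exec≗ P s s₁ × (∀ {s₂} → Exec≗ Q s₁ s₂ → Goal s₂)

Valid-respond : ∀ {Φ FU FE Ψ G} {Goal : ℕ → Store → Set} → Valid Φ FU FE Ψ → Φ G →
                (∀ k → Respond (FU k) (FE k) (G k) (Goal k)) →
                Σ[ G' ∈ GState ] Ψ G' × (∀ k → Goal k (G' k))
Valid-respond valid φ respond with valid _ φ (proj₁ ∘ respond) (λ k → proj₁ (proj₂ (respond k)))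
... | G' , R , ψ = G' , ψ , λ k → proj₂ (proj₂ (respond k)) (R k)

common-bound : ∀ {a p} {A : Set a} {P : A → ℕ → Set p} {xs : List A} →
               (∀ {x m n} → m ≤ n → P x m → P x n) →
               (∀ {x} → x ∈ xs → ∃ (P x)) → ∃[ M ] (∀ {x} → x ∈ xs → P x M)
common-bound {xs = []}     _    _      = 0 , λ ()
common-bound {xs = x ∷ xs} mono bounds with bounds (here refl) | common-bound mono (bounds ∘ there)
... | m , p | M , ps = m ⊔ M , λ { (here refl) → mono (m≤m⊔n m M) p ; (there x∈) → mono (m≤n⊔m m M) (ps x∈) }

nonempty-∈ : ∀ {a} {A : Set a} {xs : List A} → xs ≢ [] → ∃[ x ] x ∈ xs
nonempty-∈ {xs = []}    xs≢[] = ⊥-elim (xs≢[] refl)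
nonempty-∈ {xs = x ∷ _} _     = x , here refl

module _ {a} {A : Set a} where

  Unique-++⁻ˡ : ∀ (xs : List A) {ys} → Unique (xs ++ ys) → Unique xs
  Unique-++⁻ˡ []       _        = []
  Unique-++⁻ˡ (_ ∷ xs) (x∉ ∷ u) = Allₚ.++⁻ˡ xs x∉ ∷ Unique-++⁻ˡ xs u

  Unique-++⁻ʳ : ∀ (xs : List A) {ys} → Unique (xs ++ ys) → Unique ys
  Unique-++⁻ʳ []       u       = u
  Unique-++⁻ʳ (_ ∷ xs) (_ ∷ u) = Unique-++⁻ʳ xs u

  Unique-++-disjoint : ∀ (xs : List A) {ys x} → Unique (xs ++ ys) → x ∈ xs → x ∉ ys
  Unique-++-disjoint (_ ∷ xs) (x∉ ∷ _) (here refl) = All¬⇒¬Any (Allₚ.++⁻ʳ xs x∉)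
  Unique-++-disjoint (_ ∷ xs) (_ ∷ u)  (there x∈)  = Unique-++-disjoint xs u x∈

  Unique-head : ∀ {x} (xs : List A) {ys} → Unique (x ∷ xs ++ ys) → x ∉ xs × x ∉ ys
  Unique-head xs u = Unique[x∷xs]⇒x∉xs u ∘ ∈-++⁺ˡ , Unique[x∷xs]⇒x∉xs u ∘ ∈-++⁺ʳ xs

  module _ {b} {B : Set b} (f : A → B) where

    Unique-map-injective : ∀ {xs x y} → Unique (map f xs) → x ∈ xs → y ∈ xs → f x ≡ f y → x ≡ y
    Unique-map-injective (_ ∷ _)   (here refl) (here refl) _     = refl
    Unique-map-injective (fx∉ ∷ _) (here refl) (there y∈)  fx≡fy = ⊥-elim (All.lookup fx∉ (∈-map⁺ f y∈) fx≡fy)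
    Unique-map-injective (fy∉ ∷ _) (there x∈)  (here refl) fx≡fy =
      ⊥-elim (All.lookup fy∉ (∈-map⁺ f x∈) (sym fx≡fy))
    Unique-map-injective (_ ∷ u)   (there x∈)  (there y∈)  fx≡fy = Unique-map-injective u x∈ y∈ fx≡fy

    Unique-map-filter : ∀ (p : A → Bool) {xs} → Unique (map f xs) → Unique (map f (filterᵇ p xs))
    Unique-map-filter p = AllPairs.map⁺ ∘ AllPairs.filter⁺ (T? ∘ p) ∘ AllPairs.map⁻

Unique-↭ : ∀ {xs ys : List ℕ} → xs ↭ ys → Unique xs → Unique ys
Unique-↭ p = Unique-resp-↭ (↭⇒↭ₛ p)

Unique-shift : ∀ {x} (xs : List ℕ) {ys} → Unique (xs ++ x ∷ ys) → Unique (x ∷ xs ++ ys)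
Unique-shift {x} xs {ys} = Unique-↭ (shift x xs ys)

DistinctIndices : List IProg → List IProg → Set
DistinctIndices U E = Unique (map proj₁ U ++ map proj₁ E)

⟦⟧-∉ : ∀ {i} L → i ∉ map proj₁ L → ⟦ L ⟧ i ≡ skip
⟦⟧-∉ []      _  = refl
⟦⟧-∉ (_ ∷ L) i∉ = trans (if-≡ᵇ-≢ (i∉ ∘ here)) (⟦⟧-∉ L (i∉ ∘ there))

⟦⟧-∈ : ∀ {i P} L → Unique (map proj₁ L) → (i , P) ∈ L → ⟦ L ⟧ i ≡ P
⟦⟧-∈ ((i , _) ∷ _) _ (here refl) = if-≡ᵇ-refl i
⟦⟧-∈ (_ ∷ L) (j∉ ∷ u) (there iP∈) =
  trans (if-≡ᵇ-≢ (λ i≡j → All.lookup j∉ (∈-map⁺ proj₁ iP∈) (sym i≡j))) (⟦⟧-∈ L u iP∈)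

⟦⟧-↭ : ∀ {U U'} → Unique (map proj₁ U) → U ↭ U' → ∀ k → ⟦ U ⟧ k ≡ ⟦ U' ⟧ k
⟦⟧-↭ {U} {U'} u p k with k ∈? map proj₁ U
... | yes k∈ with ∈-map⁻ proj₁ k∈
...   | _ , kP∈ , refl =
  trans (⟦⟧-∈ U u kP∈) (sym (⟦⟧-∈ U' (Unique-↭ (↭-map⁺ proj₁ p) u) (∈-resp-↭ p kP∈)))
⟦⟧-↭ {U} {U'} u p k | no k∉ =
  trans (⟦⟧-∉ U k∉) (sym (⟦⟧-∉ U' (k∉ ∘ ∈-resp-↭ (↭-map⁺ proj₁ (↭-sym p)))))

∀-head : ∀ {i} U E → Unique (i ∷ map proj₁ U ++ map proj₁ E) → ⟦ U ⟧ i ≡ skip × DistinctIndices U E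
∀-head U _ u@(_ ∷ tail) = ⟦⟧-∉ U (proj₁ (Unique-head (map proj₁ U) u)) , tail

∃-head : ∀ U E {i} → Unique (map proj₁ U ++ i ∷ map proj₁ E) →
         ⟦ U ⟧ i ≡ skip × ⟦ E ⟧ i ≡ skip × DistinctIndices U E
∃-head U E u with Unique-shift (map proj₁ U) u
... | shifted@(_ ∷ tail) = ⟦⟧-∉ U (proj₁ fresh) , ⟦⟧-∉ E (proj₂ fresh) , tail
  where
    fresh : _ ∉ map proj₁ U × _ ∉ map proj₁ E
    fresh = Unique-head (map proj₁ U) shifted

ExecL⇒Runs : ∀ L {G G'} → Unique (map proj₁ L) → ExecL L G G' → Runs ⟦ L ⟧ G G'
ExecL⇒Runs []            _        G'≗G k = Exec≗-skip (≗-sym (G'≗G k))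
ExecL⇒Runs ((i , P) ∷ L) (i∉ ∷ u) (s , e , execs) =
  Runs-unshift (Runs-cong (sym ∘ [↦]-idle idle) R) (s , e , subst (_≗ _) (if-≡ᵇ-refl i) (Runs-idle idle R))
  where
    idle : ⟦ L ⟧ i ≡ skip
    idle = ⟦⟧-∉ L (All¬⇒¬Any i∉)
    R : Runs ⟦ L ⟧ (upd _ i s) _
    R = ExecL⇒Runs L u execs

Runs⇒ExecL : ∀ L {G G'} → Unique (map proj₁ L) → Runs ⟦ L ⟧ G G' → ExecL L G G'
Runs⇒ExecL []            _        R k = ≗-sym (skip-≗ (R k))
Runs⇒ExecL ((i , P) ∷ L) (i∉ ∷ u) R with Runs-at R
... | s , e , s≗ =
  s , e , Runs⇒ExecL L u (Runs-cong ([↦]-idle (⟦⟧-∉ L (All¬⇒¬Any i∉))) (Runs-shift R (Exec≗-skip s≗)))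

Valid⇒ValidFEHT : ∀ {Φ Ψ} U E → DistinctIndices U E → Valid Φ ⟦ U ⟧ ⟦ E ⟧ Ψ → ValidFEHT Φ U E Ψ
Valid⇒ValidFEHT U E u valid G₀ φ G₁ ex with valid G₀ φ G₁ (ExecL⇒Runs U (Unique-++⁻ˡ _ u) ex)
... | G₂ , R , ψ = G₂ , Runs⇒ExecL E (Unique-++⁻ʳ _ u) R , ψ

whileProg : LoopProg → Prog
whileProg r = while (guard r) (body r) ⨾ rest r

activeBody : ℕ → LoopProg → Prog
activeBody j r = if j ≤ᵇ cnt r then body r else skip

loop-indices : ∀ (f : LoopProg → Prog) LU LE →
               map proj₁ (map (λ r → idx r , f r) LU) ++ map proj₁ (map (λ r → idx r , f r) LE) ≡
               map idx LU ++ map idx LE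
loop-indices f LU LE = sym (cong₂ _++_ (map-∘ LU) (map-∘ LE))

Unique-filter-indices : ∀ (p : LoopProg → Bool) LU LE → Unique (map idx LU ++ map idx LE) →
                        Unique (map idx (filterᵇ p LU) ++ map idx (filterᵇ p LE))
Unique-filter-indices p LU LE u =
  subst Unique split (Unique-map-filter idx p (subst Unique (sym (map-++ idx LU LE)) u))
  where
    split : map idx (filterᵇ p (LU ++ LE)) ≡ map idx (filterᵇ p LU) ++ map idx (filterᵇ p LE)
    split = trans (cong (map idx) (filter-++ (T? ∘ p) LU LE)) (map-++ idx (filterᵇ p LU) (filterᵇ p LE))

module _ (f : LoopProg → Prog) where

  loops-∈ : ∀ {L r} → Unique (map idx L) → r ∈ L → ⟦ map (λ r → idx r , f r) L ⟧ (idx r) ≡ f r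
  loops-∈ {L} u r∈ = ⟦⟧-∈ _ (subst Unique (map-∘ L) u) (∈-map⁺ _ r∈)

  loops-∉ : ∀ {L k} → k ∉ map idx L → ⟦ map (λ r → idx r , f r) L ⟧ k ≡ skip
  loops-∉ {L} k∉ = ⟦⟧-∉ _ (subst (_ ∉_) (map-∘ L) k∉)

  filtered-∈ : ∀ (p : LoopProg → Bool) {L r} → Unique (map idx L) → r ∈ L →
               ⟦ map (λ r → idx r , f r) (filterᵇ p L) ⟧ (idx r) ≡ (if p r then f r else skip)
  filtered-∈ p {L} {r} u r∈ with p r in pr
  ... | true  = loops-∈ (Unique-map-filter idx p u) (∈-filter⁺ (T? ∘ p) r∈ (subst T (sym pr) tt))
  ... | false = loops-∉ λ idx∈ →
    let (r' , r'∈ , idx≡) = ∈-map⁻ idx idx∈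
        (r'∈L , pr') = ∈-filter⁻ (T? ∘ p) {xs = L} r'∈
    in subst T (trans (cong p (Unique-map-injective idx u r'∈L r∈ (sym idx≡))) pr) pr'

  filtered-∉ : ∀ (p : LoopProg → Bool) {L k} → k ∉ map idx L →
               ⟦ map (λ r → idx r , f r) (filterᵇ p L) ⟧ k ≡ skip
  filtered-∉ p {L} k∉ = loops-∉ λ k∈ →
    let (r , r∈ , k≡) = ∈-map⁻ idx k∈
    in k∉ (subst (_∈ _) (sym k≡) (∈-map⁺ idx (proj₁ (∈-filter⁻ (T? ∘ p) {xs = L} r∈))))

-- Iterations a universal loop may still perform at the start of round j of a pass
-- after which at most M remain.
budget : ℕ → ℕ → LoopProg → ℕ
budget j M r = if j ≤ᵇ cnt r then suc M else M

budget-≥ : ∀ j M r → M ≤ budget j M r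
budget-≥ j M r with j ≤ᵇ cnt r
... | true  = n≤1+n M
... | false = ≤-refl

budget-active : ∀ j M r → j ≤ cnt r → budget j M r ≡ suc M
budget-active j M r j≤c with j ≤ᵇ cnt r | ≤⇒≤ᵇ j≤c
... | true  | _  = refl
... | false | ()

budget-inactive : ∀ j M r → cnt r < j → budget j M r ≡ M
budget-inactive j M r c<j with j ≤ᵇ cnt r | ≤ᵇ⇒≤ j (cnt r)
... | false | _   = refl
... | true  | j≤c = ⊥-elim (<⇒≱ c<j (j≤c tt))

module Loops (LU LE : List LoopProg) (unique : Unique (map idx LU ++ map idx LE)) where

  data Role (k : ℕ) : Set where
    universal   : ∀ r → r ∈ LU → idx r ≡ k → Role k
    existential : ∀ r → r ∈ LE → idx r ≡ k → Role k
    idle        : k ∉ map idx LU → k ∉ map idx LE → Role k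

  role : ∀ k → Role k
  role k with k ∈? map idx LU | k ∈? map idx LE
  ... | yes k∈ | _      = let (r , r∈ , k≡) = ∈-map⁻ idx k∈ in universal r r∈ (sym k≡)
  ... | no _   | yes k∈ = let (r , r∈ , k≡) = ∈-map⁻ idx k∈ in existential r r∈ (sym k≡)
  ... | no k∉U | no k∉E = idle k∉U k∉E

  onU onE : ∀ {k} → (LoopProg → Prog) → Role k → Prog
  onU f (universal r _ _)   = f r
  onU f _                   = skip
  onE f (existential r _ _) = f r
  onE f _                   = skip

  private
    uniqueU : Unique (map idx LU)
    uniqueU = Unique-++⁻ˡ (map idx LU) unique

    uniqueE : Unique (map idx LE)
    uniqueE = Unique-++⁻ʳ (map idx LU) unique

    universal∉E : ∀ {r} → r ∈ LU → idx r ∉ map idx LE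
    universal∉E r∈ = Unique-++-disjoint (map idx LU) unique (∈-map⁺ idx r∈)

    existential∉U : ∀ {r} → r ∈ LE → idx r ∉ map idx LU
    existential∉U r∈ idx∈ = Unique-++-disjoint (map idx LU) unique idx∈ (∈-map⁺ idx r∈)

  family-U : ∀ f {k} (ρ : Role k) → ⟦ map (λ r → idx r , f r) LU ⟧ k ≡ onU f ρ
  family-U f (universal r r∈ refl)   = loops-∈ f uniqueU r∈
  family-U f (existential r r∈ refl) = loops-∉ f (existential∉U r∈)
  family-U f (idle k∉ _)             = loops-∉ f k∉

  family-E : ∀ f {k} (ρ : Role k) → ⟦ map (λ r → idx r , f r) LE ⟧ k ≡ onE f ρ
  family-E f (universal r r∈ refl)   = loops-∉ f (universal∉E r∈)
  family-E f (existential r r∈ refl) = loops-∈ f uniqueE r∈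
  family-E f (idle _ k∉)             = loops-∉ f k∉

  active-U : ∀ j {k} (ρ : Role k) → ⟦ map bodyOf (activeIn j LU) ⟧ k ≡ onU (activeBody j) ρ
  active-U j (universal r r∈ refl)   = filtered-∈ body (λ r → j ≤ᵇ cnt r) uniqueU r∈
  active-U j (existential r r∈ refl) = filtered-∉ body _ (existential∉U r∈)
  active-U j (idle k∉ _)             = filtered-∉ body _ k∉

  active-E : ∀ j {k} (ρ : Role k) → ⟦ map bodyOf (activeIn j LE) ⟧ k ≡ onE (activeBody j) ρ
  active-E j (universal r r∈ refl)   = filtered-∉ body _ (universal∉E r∈)
  active-E j (existential r r∈ refl) = filtered-∈ body (λ r → j ≤ᵇ cnt r) uniqueE r∈
  active-E j (idle _ k∉)             = filtered-∉ body _ k∉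

  -- s is the current store of component k and u its store after the universal programs:
  -- a universal loop still gets from s to u, within μ r iterations; an existential loop
  -- reaches from u whatever it reaches from s.
  RoleInv : ∀ {k} → Role k → (LoopProg → ℕ) → Store → Store → Set
  RoleInv (universal r _ _)   μ s u = Exec≗ (bounded (guard r) (body r) (μ r) ⨾ rest r) s u
  RoleInv (existential r _ _) _ s u = ∀ {v} → Exec≗ (whileProg r) s v → Exec≗ (whileProg r) u v
  RoleInv (idle _ _)          _ s u = s ≗ u

  RoleInv-mono : ∀ {μ μ' k s u} → (∀ {r} → r ∈ LU → μ r ≤ μ' r) → (ρ : Role k) →
                 RoleInv ρ μ s u → RoleInv ρ μ' s u
  RoleInv-mono μ≤μ' (universal r r∈ _)  = pending-mono (μ≤μ' r∈)
  RoleInv-mono _    (existential _ _ _) p = p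
  RoleInv-mono _    (idle _ _)          p = p

  advance : ∀ {j M G k u} (ρ : Role k) → GuardsT (activeIn j LU ++ activeIn j LE) G →
            RoleInv ρ (budget j M) (G k) u →
            Respond (onU (activeBody j) ρ) (onE (activeBody j) ρ) (G k) (λ s → RoleInv ρ (λ _ → M) s u)
  advance {j} {G = G} (universal r r∈ refl) active p with j ≤ᵇ cnt r in act
  ... | true  =
    let (m , e , p') = pending-peel running p in m , (m , e , ≗-refl) , λ q → Exec≗-cong (skip-≗ q) ≗-refl p'
    where
      running : evalB (guard r) (G (idx r)) ≡ true
      running = All.lookup (Allₚ.++⁻ˡ (activeIn j LU) active) (∈-filter⁺ (T? ∘ _) r∈ (subst T (sym act) tt))
  ... | false = G (idx r) , Exec≗-skip ≗-refl , λ q → Exec≗-cong (skip-≗ q) ≗-refl p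
  advance {j} {G = G} (existential r r∈ refl) active p with j ≤ᵇ cnt r in act
  ... | true  = G (idx r) , Exec≗-skip ≗-refl , λ q w → p (while-unfold running q w)
    where
      running : evalB (guard r) (G (idx r)) ≡ true
      running = All.lookup (Allₚ.++⁻ʳ (activeIn j LU) active) (∈-filter⁺ (T? ∘ _) r∈ (subst T (sym act) tt))
  ... | false = G (idx r) , Exec≗-skip ≗-refl , λ q w → p (Exec≗-cong (≗-sym (skip-≗ q)) ≗-refl w)
  advance (idle _ _) _ p = _ , Exec≗-skip ≗-refl , λ q → ≗-trans (≗-sym (skip-≗ q)) p

  leave : ∀ {μ G k u} (ρ : Role k) → GuardsF (LU ++ LE) G → RoleInv ρ μ (G k) u →
          Respond (onU rest ρ) (onE rest ρ) (G k) (Exec≗ (onE whileProg ρ) u)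
  leave (universal r r∈ refl)   exiting p =
    _ , pending-exit (All.lookup (Allₚ.++⁻ˡ LU exiting) r∈) p , λ q → q
  leave (existential r r∈ refl) exiting p =
    _ , Exec≗-skip ≗-refl , λ q → p (while-exit (All.lookup (Allₚ.++⁻ʳ LU exiting) r∈) q)
  leave (idle _ _)              _       p = _ , Exec≗-skip ≗-refl , Exec≗-cong p ≗-refl

  exhausted : ∀ {G k u} (ρ : Role k) → k ∈ map idx LU → GuardsT (LU ++ LE) G →
              ¬ RoleInv ρ (λ _ → 0) (G k) u
  exhausted (universal r r∈ refl)   _  running =
    pending-zero {P = body r} (All.lookup (Allₚ.++⁻ˡ LU running) r∈)
  exhausted (existential r r∈ refl) k∈ _ _     = existential∉U r∈ k∈
  exhausted (idle k∉ _)             k∈ _ _     = k∉ k∈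

  module _ {Φ Ψ : Assertion} (I : Assertion) (B : ℕ) (Is : ℕ → Assertion)
    (nonempty : LU ≢ [])
    (counts : All (λ r → 1 ≤ cnt r × cnt r ≤ B) (LU ++ LE))
    (first : Is 1 ≡ I) (last : Is (suc B) ≡ I)
    (entry : ∀ G → Φ G → I G)
    (guards : ∀ G → I G → GuardsT (LU ++ LE) G ⊎ GuardsF (LU ++ LE) G)
    (round-valid : ∀ j → 1 ≤ j → j ≤ B →
       Valid (λ G → Is j G × GuardsT (activeIn j LU ++ activeIn j LE) G)
             ⟦ map bodyOf (activeIn j LU) ⟧ ⟦ map bodyOf (activeIn j LE) ⟧
             (λ G → Is (suc j) G × GuardsT (runningAfter j LU ++ runningAfter j LE) G))
    (exit-valid : Valid (λ G → I G × GuardsF (LU ++ LE) G) ⟦ map restOf LU ⟧ ⟦ map restOf LE ⟧ Ψ)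
    where

    private
      count : ∀ {r} → r ∈ LU → 1 ≤ cnt r × cnt r ≤ B
      count r∈ = All.lookup (Allₚ.++⁻ˡ LU counts) r∈

    module _ (G₁ : GState) where

      Inv : (LoopProg → ℕ) → GState → Set
      Inv μ G = ∀ k → RoleInv (role k) μ (G k) (G₁ k)

      Inv-mono : ∀ {μ μ' G} → (∀ {r} → r ∈ LU → μ r ≤ μ' r) → Inv μ G → Inv μ' G
      Inv-mono μ≤μ' inv k = RoleInv-mono μ≤μ' (role k) (inv k)

      round : ∀ {j M G} → 1 ≤ j → j ≤ B → Is j G → GuardsT (activeIn j LU ++ activeIn j LE) G →
              Inv (budget j M) G →
              Σ[ G' ∈ GState ] (Is (suc j) G' × GuardsT (activeIn (suc j) LU ++ activeIn (suc j) LE) G') ×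
                               Inv (λ _ → M) G'
      round {j} {M} 1≤j j≤B is active inv =
        Valid-respond (Valid-cong (active-U j ∘ role) (active-E j ∘ role) (round-valid j 1≤j j≤B)) (is , active)
          (λ k → advance {j} {M} (role k) active (inv k))

      rounds : ∀ d {j M G} → d + j ≡ suc B → 1 ≤ j → Is j G → GuardsT (activeIn j LU ++ activeIn j LE) G →
               Inv (budget j M) G → Σ[ G' ∈ GState ] I G' × Inv (λ _ → M) G'
      rounds zero {M = M} {G} refl _ is _ inv =
        G , subst (λ A → A G) last is ,
        Inv-mono (λ {r} r∈ → ≤-reflexive (budget-inactive (suc B) M r (s≤s (proj₂ (count r∈))))) inv
      rounds (suc d) {j} {M} eq 1≤j is active inv
        with round 1≤j (subst (j ≤_) (suc-injective eq) (m≤n+m j d)) is active inv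
      ... | G' , (is' , active') , inv' =
        rounds d (trans (+-suc d j) eq) (s≤s z≤n) is' active' (Inv-mono (λ {r} _ → budget-≥ (suc j) M r) inv')

      next-pass : ∀ {M G} → I G → GuardsT (LU ++ LE) G → Inv (λ _ → suc M) G →
                  Σ[ G' ∈ GState ] I G' × Inv (λ _ → M) G'
      next-pass {M} {G} iG running inv =
        rounds B (+-comm B 1) ≤-refl (subst (λ A → A G) (sym first) iG) enter
          (Inv-mono (λ {r} r∈ → ≤-reflexive (sym (budget-active 1 M r (proj₁ (count r∈))))) inv)
        where
          enter : GuardsT (activeIn 1 LU ++ activeIn 1 LE) G
          enter = Allₚ.++⁺ (Allₚ.filter⁺ _ (Allₚ.++⁻ˡ LU running)) (Allₚ.filter⁺ _ (Allₚ.++⁻ʳ LU running))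

      out-of-budget : ∀ {G} → GuardsT (LU ++ LE) G → ¬ Inv (λ _ → 0) G
      out-of-budget running inv =
        let (r₀ , r₀∈) = nonempty-∈ nonempty
        in exhausted (role (idx r₀)) (∈-map⁺ idx r₀∈) running (inv (idx r₀))

      exit : ∀ {μ G} → I G → GuardsF (LU ++ LE) G → Inv μ G →
             Σ[ G₂ ∈ GState ] Runs ⟦ map whileOf LE ⟧ G₁ G₂ × Ψ G₂
      exit iG exiting inv
        with Valid-respond (Valid-cong (family-U rest ∘ role) (family-E rest ∘ role) exit-valid) (iG , exiting)
               (λ k → leave (role k) exiting (inv k))
      ... | G₂ , ψ , R = G₂ , Runs-cong (sym ∘ family-E whileProg ∘ role) R , ψ

      iterate : ∀ M {G} → I G → Inv (λ _ → M) G → Σ[ G₂ ∈ GState ] Runs ⟦ map whileOf LE ⟧ G₁ G₂ × Ψ G₂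
      iterate zero {G} iG inv with guards G iG
      ... | inj₁ running = ⊥-elim (out-of-budget running inv)
      ... | inj₂ exiting = exit iG exiting inv
      iterate (suc M) {G} iG inv with guards G iG
      ... | inj₁ running = let (G' , iG' , inv') = next-pass iG running inv in iterate M iG' inv'
      ... | inj₂ exiting = exit iG exiting inv

    start : ∀ {G₀ G₁} → Runs ⟦ map whileOf LU ⟧ G₀ G₁ → ∃[ M ] Inv G₁ (λ _ → M) G₀
    start {G₀} {G₁} R =
      let (M , pending) = common-bound pending-mono (λ r∈ → while⇒pending (runs (universal _ r∈ refl)))
      in M , λ k → initially pending (role k)
      where
        runs : ∀ {k} (ρ : Role k) → Exec≗ (onU whileProg ρ) (G₀ k) (G₁ k)
        runs {k} ρ = subst (λ P → Exec≗ P _ _) (family-U whileProg ρ) (R k)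

        initially : ∀ {M k} →
                    (∀ {r} → r ∈ LU → Exec≗ (bounded (guard r) (body r) M ⨾ rest r) (G₀ (idx r)) (G₁ (idx r))) →
                    (ρ : Role k) → RoleInv ρ (λ _ → M) (G₀ k) (G₁ k)
        initially pending (universal r r∈ refl)   = pending r∈
        initially _       (existential r r∈ refl) = Exec≗-cong (skip-≗ (runs (existential r r∈ refl))) ≗-refl
        initially _       (idle k∉U k∉E)          = skip-≗ (runs (idle k∉U k∉E))

    valid : Valid Φ ⟦ map whileOf LU ⟧ ⟦ map whileOf LE ⟧ Ψ
    valid G₀ φ G₁ R = let (M , inv) = start R in iterate G₁ M (entry G₀ φ) inv

module Soundness (⊢H ⊢U : ProofSystem)
  (hoare : ∀ {i Φ P Φ'} → ⊢H i Φ P Φ' → HoareValid i Φ P Φ')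
  (under : ∀ {i Φ P Φ'} → ⊢U i Φ P Φ' → UnderValid i Φ P Φ')
  where

  open FEHL ⊢H ⊢U

  sound : ∀ {Φ Ψ U E} → DistinctIndices U E → ⊢ Φ ⟨ U ⟩⟨ E ⟩ Ψ → Valid Φ ⟦ U ⟧ ⟦ E ⟧ Ψ
  sound u (reorder∀ {U = U} {E = E} p d) =
    Valid-cong (λ k → sym (⟦⟧-↭ (Unique-++⁻ˡ (map proj₁ U) u) p k)) (λ _ → refl)
      (sound (Unique-↭ (++⁺ʳ (map proj₁ E) (↭-map⁺ proj₁ p)) u) d)
  sound u (reorder∃ {U = U} {E = E} p d) =
    Valid-cong (λ _ → refl) (λ k → sym (⟦⟧-↭ (Unique-++⁻ʳ (map proj₁ U) u) p k))
      (sound (Unique-↭ (++⁺ˡ (map proj₁ U) (↭-map⁺ proj₁ p)) u) d)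
  sound u (seqSkip∀ d) = Valid-⊑∀ ⨾-skip⁺ (sound u d)
  sound u (seqSkip∃ d) = Valid-⊑∃ ⨾-skip⁻ (sound u d)
  sound u (elimSkip∀ {U = U} {E} d) = let (idle , u') = ∀-head U E u in Valid-idle∀ idle (sound u' d)
  sound u (elimSkip∃ {U = U} {E} d) = let (_ , idle , u') = ∃-head U E u in Valid-idle∃ idle (sound u' d)
  sound u (assoc∀ d) = Valid-⊑∀ ⨾-assoc⁺ (sound u d)
  sound u (assoc∃ d) = Valid-⊑∃ ⨾-assoc⁻ (sound u d)
  sound u done G₀ φ G₁ R = G₀ , (λ k → Exec≗-skip (≗-sym (skip-≗ (R k)))) , φ
  sound u (cons pre d post) G₀ φ G₁ R =
    let (G₂ , R₂ , ψ) = sound u d G₀ (pre G₀ φ) G₁ R in G₂ , R₂ , post G₂ ψ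
  sound u (if∀ d₁ d₂) G₀ φ G₁ R with Runs-at R
  ... | t , ex-seq (ex-ifT g e₁) e₃ , t≗ = sound u d₁ G₀ (φ , g) G₁ (Runs-set R (t , ex-seq e₁ e₃ , t≗))
  ... | t , ex-seq (ex-ifF g e₂) e₃ , t≗ = sound u d₂ G₀ (φ , g) G₁ (Runs-set R (t , ex-seq e₂ e₃ , t≗))
  sound u (if∃ {U = U} {E} {i} {b} d₁ d₂) G₀ φ with evalB b (G₀ i) in g
  ... | true  = Valid-guarded∃ b (proj₁ (∃-head U E u)) (λ _ → proj₂)
                  (λ { g (ex-seq e₁ e₃) → ex-seq (ex-ifT g e₁) e₃ }) (sound u d₁) G₀ (φ , g)
  ... | false = Valid-guarded∃ b (proj₁ (∃-head U E u)) (λ _ → proj₂)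
                  (λ { g (ex-seq e₂ e₃) → ex-seq (ex-ifF g e₂) e₃ }) (sound u d₂) G₀ (φ , g)
  sound u (step∀ h d) = Valid-prefix∀ (hoare h) (sound u d)
  sound u (step∃ {U = U} {E} h d) = Valid-prefix∃ (proj₁ (∃-head U E u)) (under h) (sound u d)
  sound u (assume∀ d) G₀ φ G₁ R with Runs-at R
  ... | t , ex-seq (ex-assume g) e , t≗ = sound u d G₀ (φ , g) G₁ (Runs-set R (t , e , t≗))
  sound u (assume∃ {U = U} {E} {b = b} holds d) =
    Valid-guarded∃ b (proj₁ (∃-head U E u)) holds (λ g → ex-seq (ex-assume g)) (sound u d)
  sound u (choice∀ d) = Valid-prefix∀ choice-hoare (sound u d)
  sound u (choice∃ {U = U} {E} e x∉ d) =
    Valid-prefix∃ (proj₁ (∃-head U E u)) (choice-under e x∉) (sound u d)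
  sound u (havoc∀ {U = U} {E} d) =
    let (idle , u') = ∀-head U E u
    in Valid-⊑∀ ⨾-skip⁺ (Valid-prefix∀ havoc-hoare (Valid-idle∀ idle (sound u' d)))
  sound u (havoc∃ {U = U} {E} h d) =
    let (idleU , idleE , u') = ∃-head U E u
    in Valid-⊑∃ ⨾-skip⁻
         (Valid-prefix∃ idleU (havoc-under {Φ' = Top} (under h)) (Valid-idle∃ idleE (sound u' d)))
  sound u (loop LU LE I B Is nonempty counts first last entry guards rounds exit) =
    Loops.valid LU LE unique I B Is nonempty counts first last entry guards
      (λ j 1≤j j≤B → sound (active-unique j) (rounds j 1≤j j≤B))
      (sound (subst Unique (sym (loop-indices rest LU LE)) unique) exit)
    where
      unique : Unique (map idx LU ++ map idx LE)
      unique = subst Unique (loop-indices whileProg LU LE) u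
      active-unique : ∀ j → DistinctIndices (map bodyOf (activeIn j LU)) (map bodyOf (activeIn j LE))
      active-unique j = subst Unique (sym (loop-indices body (activeIn j LU) (activeIn j LE)))
                          (Unique-filter-indices (λ r → j ≤ᵇ cnt r) LU LE unique)

theorem1 : (⊢H ⊢U : ProofSystem) →
           (∀ {i Φ P Φ'} → ⊢H i Φ P Φ' → HoareValid i Φ P Φ') →
           (∀ {i Φ P Φ'} → ⊢U i Φ P Φ' → UnderValid i Φ P Φ') →
           ∀ {Φ Ψ : Assertion} {U E : List IProg} →
           Unique (map proj₁ (U ++ E)) →
           FEHL.⊢_⟨_⟩⟨_⟩_ ⊢H ⊢U Φ U E Ψ →
           ValidFEHT Φ U E Ψ
theorem1 ⊢H ⊢U hoare under {U = U} {E} u d =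
  Valid⇒ValidFEHT U E distinct (Soundness.sound ⊢H ⊢U hoare under distinct d)
  where
    distinct : DistinctIndices U E
    distinct = subst Unique (map-++ proj₁ U E) u
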